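{- Let $k \ge 3$ and $d \in \mathbb{N}$. Then, as formal power series, \[ C_d^{(k)}(y) = y^d\,\bigl(H_{k-1}(y)\bigr)^{\lfloor d/k\rfloor+1}. \]
   Context: Words are over the alphabet $\mathbb{N}=\{0,1,2,\dots\}$ (letters called digits). For $k\ge 2$, $\phi_k:\mathbb{N}^*\to\mathbb{N}^*$ is the morphism defined for $i\in\mathbb{N}$, $0\le j\le k-1$ by $\phi_k(ki+j)=(ki)(ki+j+1)$ if $0\le j\le k-2$ and $\phi_k(ki+k-1)=ki+k$. Set $W_n^{(k)}=\phi_k^n(0)$. For a digit $d$, $c^{(k)}(d;n)$ is the number of occurrences of $d$ in $W_n^{(k)}$ and $C_d^{(k)}(y)=\sum_{n\ge0}c^{(k)}(d;n)y^n$. $H_{k-1}(y)=1/(1-y-y^2-\cdots-y^{k-1})$ as a formal power series. -}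

module Defs where

open import Data.Nat using (ℕ; zero; suc; _+_; _*_; _∸_; _^_; _≤_; _<_; _<ᵇ_; NonZero)
open import Data.Nat.DivMod using (_/_; _%_)
open import Data.Nat.Properties using (_≟_)
open import Data.List using (List; []; _∷_; concatMap; filter; length; take; map; upTo)
open import Data.Nat.ListAction using (sum)
open import Relation.Nullary using (yes; no)
open import Data.Bool using (true; false)
open import Data.Bool using (if_then_else_)

Word : Set
Word = List ℕ

φ-letter : (k : ℕ) → .{{NonZero k}} → ℕ → Word
φ-letter k m with suc (m % k) <ᵇ k
... | true  = (k * (m / k)) ∷ (k * (m / k) + (m % k) + 1) ∷ []
... | false = (k * (m / k) + k) ∷ []

φ : (k : ℕ) → .{{NonZero k}} → Word → Word
φ k w = concatMap (φ-letter k) w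

iter : {A : Set} → (A → A) → ℕ → A → A
iter f zero    x = x
iter f (suc n) x = f (iter f n x)

W : (k : ℕ) → .{{NonZero k}} → ℕ → Word
W k n = iter (φ k) n (0 ∷ [])

occ : ℕ → Word → ℕ
occ d w = length (filter (_≟ d) w)

c : (k : ℕ) → .{{NonZero k}} → ℕ → ℕ → ℕ
c k d n = occ d (W k n)

-- Formal power series over ℕ, represented by coefficient sequences
Series : Set
Series = ℕ → ℕ

_⊛_ : Series → Series → Series
(f ⊛ g) n = sum (map (λ i → f i * g (n ∸ i)) (upTo (suc n)))

one : Series
one zero    = 1
one (suc _) = 0

pow : Series → ℕ → Series
pow f zero    = one
pow f (suc m) = f ⊛ pow f m

mono : ℕ → Series
mono d n with n ≟ d
... | yes _ = 1
... | no _ = 0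

-- Coefficients of H m (y) = H_m(y) = 1/(1 - y - ... - y^m):
-- h 0 = 1 and h n = Σ_{1 ≤ i ≤ m, i ≤ n} h (n - i)  (the expansion of the inverse).
-- hs m n is the list [h n, h (n-1), ..., h 0].
hs : ℕ → ℕ → List ℕ
hs m zero    = 1 ∷ []
hs m (suc n) = sum (take m (hs m n)) ∷ hs m n

H : ℕ → Series
H m n with hs m n
... | []    = 0
... | x ∷ _ = x

C : (k : ℕ) → .{{NonZero k}} → ℕ → Series
C k d n = c k d n

{-# OPTIONS --safe #-}
module Submission where

-- A letter x = qk + r with r < k is sent by φ_k to x + 1, preceded by the letter qk
-- when r < k - 1. So for 0 < j < k the digit ik + j occurs in W_{n+1} as often as
-- ik + j - 1 occurs in W_n, while ik occurs as often as ik - 1, ik, ik + 1, …, ik + k - 2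
-- together. Writing H = H_{k-1}, the identity H = 1 + (y + ⋯ + y^(k-1)) H shows that the
-- coefficients of y^(ik+j) H^(i+1) obey the same recurrences, and an induction on n,
-- simultaneously for all digits, gives C_{ik+j} = y^(ik+j) H^(i+1).

open import Defs
open import Data.Nat using (ℕ; zero; suc; _+_; _*_; _∸_; _≤_; _<_; _<ᵇ_; _≡ᵇ_; NonZero; s≤s; z<s)
open import Data.Nat.Properties
open import Data.Nat.DivMod using (_/_; _%_; m≡m%n+[m/n]*n; [m+kn]%n≡m%n; m<n⇒m%n≡m; m%n<n)
open import Data.Nat.ListAction using (sum)
open import Data.Nat.Tactic.RingSolver using (solve-∀)
open import Data.Bool using (true; false; if_then_else_; T)
open import Data.Fin using (Fin; toℕ)
open import Data.Fin.Properties using (toℕ<n)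
open import Data.List using ([]; _∷_; _++_; [_]; map; concatMap; filter; length; take; upTo; applyUpTo)
open import Data.List.Properties using (filter-++; length-++; map-applyUpTo; map-upTo; map-cong; take-[])
open import Data.Product using (_×_; _,_; proj₁; proj₂)
open import Function using (_∘_)
open import Relation.Nullary using (yes; no; does)
open import Relation.Nullary.Decidable using (dec-true; dec-false)
open import Relation.Binary.PropositionalEquality hiding ([_])
open ≡-Reasoning
open import Algebra.Properties.CommutativeSemigroup +-commutativeSemigroup using (interchange)
open import Algebra.Properties.CommutativeMonoid.Sum +-0-commutativeMonoid
  using (sum-syntax; sum-cong-≗; sum-replicate-zero; ∑-distrib-+)

iter-comm : {A : Set} (f : A → A) (n : ℕ) (x : A) → iter f n (f x) ≡ f (iter f n x)
iter-comm f zero    x = refl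
iter-comm f (suc n) x = cong f (iter-comm f n x)

infixl 6 _⊕_

_⊕_ : Series → Series → Series
(f ⊕ g) n = f n + g n

shift : Series → Series
shift f zero    = 0
shift f (suc n) = f n

geom : ℕ → Series → Series
geom zero    f n = 0
geom (suc m) f n = f n + shift (geom m f) n

shift-cong : ∀ {f g} → f ≗ g → shift f ≗ shift g
shift-cong f≗g zero    = refl
shift-cong f≗g (suc n) = f≗g n

iter-shift-cong : ∀ d {f g} → f ≗ g → iter shift d f ≗ iter shift d g
iter-shift-cong zero    f≗g = f≗g
iter-shift-cong (suc d) f≗g = shift-cong (iter-shift-cong d f≗g)

iter-shift-⊕ : ∀ d f g → iter shift d (f ⊕ g) ≗ iter shift d f ⊕ iter shift d g
iter-shift-⊕ zero    f g n       = refl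
iter-shift-⊕ (suc d) f g zero    = refl
iter-shift-⊕ (suc d) f g (suc n) = iter-shift-⊕ d f g n

iter-shift-zero : ∀ d n → iter shift d (λ _ → 0) n ≡ 0
iter-shift-zero zero    n       = refl
iter-shift-zero (suc d) zero    = refl
iter-shift-zero (suc d) (suc n) = iter-shift-zero d n

∑-iter-shift : ∀ m d f n → ∑[ j < m ] iter shift (toℕ j + d) f n ≡ iter shift d (geom m f) n
∑-iter-shift zero    d f n = sym (iter-shift-zero d n)
∑-iter-shift (suc m) d f n = begin
  iter shift d f n + ∑[ j < m ] shift (iter shift (toℕ j + d) f) n
    ≡⟨ cong (iter shift d f n +_) (∑-shifted n) ⟩
  iter shift d f n + iter shift d (shift (geom m f)) n
    ≡⟨ iter-shift-⊕ d f (shift (geom m f)) n ⟨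
  iter shift d (geom (suc m) f) n ∎
  where
  ∑-shifted : ∀ n → ∑[ j < m ] shift (iter shift (toℕ j + d) f) n ≡ iter shift d (shift (geom m f)) n
  ∑-shifted zero    = trans (sum-replicate-zero m) (sym (cong-app (iter-comm shift d (geom m f)) 0))
  ∑-shifted (suc n) = trans (∑-iter-shift m d f n) (sym (cong-app (iter-comm shift d (geom m f)) (suc n)))

sum-map-upTo : ∀ (h : ℕ → ℕ) n → sum (map h (upTo n)) ≡ ∑[ i < n ] h (toℕ i)
sum-map-upTo h zero    = refl
sum-map-upTo h (suc n) = cong (h 0 +_) (begin
  sum (map h (applyUpTo suc n))  ≡⟨ cong sum (map-applyUpTo suc h n) ⟩
  sum (applyUpTo (h ∘ suc) n)    ≡⟨ cong sum (map-upTo (h ∘ suc) n) ⟨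
  sum (map (h ∘ suc) (upTo n))   ≡⟨ sum-map-upTo (h ∘ suc) n ⟩
  ∑[ i < n ] h (suc (toℕ i))     ∎)

⊛≡∑ : ∀ f g n → (f ⊛ g) n ≡ ∑[ i < suc n ] (f (toℕ i) * g (n ∸ toℕ i))
⊛≡∑ f g n = sum-map-upTo (λ i → f i * g (n ∸ i)) (suc n)

⊛-congˡ : ∀ {f f′} → f ≗ f′ → ∀ g → f ⊛ g ≗ f′ ⊛ g
⊛-congˡ f≗f′ g n = cong sum (map-cong (λ i → cong (_* g (n ∸ i)) (f≗f′ i)) (upTo (suc n)))

⊛-distribʳ-⊕ : ∀ f f′ g → (f ⊕ f′) ⊛ g ≗ f ⊛ g ⊕ f′ ⊛ g
⊛-distribʳ-⊕ f f′ g n = begin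
  ((f ⊕ f′) ⊛ g) n                          ≡⟨ ⊛≡∑ (f ⊕ f′) g n ⟩
  ∑[ i < suc n ] a₀ i                       ≡⟨ sum-cong-≗ {suc n} {a₀} distrib ⟩
  ∑[ i < suc n ] (a i + a′ i)               ≡⟨ ∑-distrib-+ a a′ ⟩
  ∑[ i < suc n ] a i + ∑[ i < suc n ] a′ i  ≡⟨ cong₂ _+_ (⊛≡∑ f g n) (⊛≡∑ f′ g n) ⟨
  (f ⊛ g) n + (f′ ⊛ g) n                    ∎
  where
  a₀ a a′ : Fin (suc n) → ℕ
  a₀ i = (f (toℕ i) + f′ (toℕ i)) * g (n ∸ toℕ i)
  a  i = f (toℕ i) * g (n ∸ toℕ i)
  a′ i = f′ (toℕ i) * g (n ∸ toℕ i)
  distrib : ∀ i → a₀ i ≡ a i + a′ i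
  distrib i = *-distribʳ-+ (g (n ∸ toℕ i)) (f (toℕ i)) (f′ (toℕ i))

⊛-identityˡ : ∀ g → one ⊛ g ≗ g
⊛-identityˡ g n = begin
  (one ⊛ g) n                   ≡⟨ ⊛≡∑ one g n ⟩
  1 * g n + ∑[ i < n ] 0        ≡⟨ cong₂ _+_ (*-identityˡ (g n)) (sum-replicate-zero n) ⟩
  g n + 0                       ≡⟨ +-identityʳ (g n) ⟩
  g n                           ∎

⊛-shiftˡ : ∀ f g → shift f ⊛ g ≗ shift (f ⊛ g)
⊛-shiftˡ f g zero    = refl
⊛-shiftˡ f g (suc n) = trans (⊛≡∑ (shift f) g (suc n)) (sym (⊛≡∑ f g n))

⊛-geomˡ : ∀ m f g → geom m f ⊛ g ≗ geom m (f ⊛ g)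
⊛-geomˡ zero    f g n = trans (⊛≡∑ (geom zero f) g n) (sum-replicate-zero (suc n))
⊛-geomˡ (suc m) f g n = begin
  (geom (suc m) f ⊛ g) n                ≡⟨ ⊛-distribʳ-⊕ f (shift (geom m f)) g n ⟩
  (f ⊛ g) n + (shift (geom m f) ⊛ g) n  ≡⟨ cong ((f ⊛ g) n +_) (⊛-shiftˡ (geom m f) g n) ⟩
  (f ⊛ g) n + shift (geom m f ⊛ g) n    ≡⟨ cong ((f ⊛ g) n +_) (shift-cong (⊛-geomˡ m f g) n) ⟩
  geom (suc m) (f ⊛ g) n                ∎

sum-take-hs : ∀ m j n → sum (take j (hs m n)) ≡ geom j (H m) n
sum-take-hs m zero    n       = refl
sum-take-hs m (suc j) zero    = cong (λ xs → suc (sum xs)) (take-[] j)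
sum-take-hs m (suc j) (suc n) = cong (H m (suc n) +_) (sum-take-hs m j n)

H-rec : ∀ m → H m ≗ one ⊕ shift (geom m (H m))
H-rec m zero    = refl
H-rec m (suc n) = sum-take-hs m m n

H-⊛-rec : ∀ m g → H m ⊛ g ≗ g ⊕ shift (geom m (H m ⊛ g))
H-⊛-rec m g n = begin
  (H m ⊛ g) n                                 ≡⟨ ⊛-congˡ (H-rec m) g n ⟩
  ((one ⊕ shift (geom m (H m))) ⊛ g) n        ≡⟨ ⊛-distribʳ-⊕ one (shift (geom m (H m))) g n ⟩
  (one ⊛ g) n + (shift (geom m (H m)) ⊛ g) n
    ≡⟨ cong₂ _+_ (⊛-identityˡ g n) (⊛-shiftˡ (geom m (H m)) g n) ⟩
  g n + shift (geom m (H m) ⊛ g) n            ≡⟨ cong (g n +_) (shift-cong (⊛-geomˡ m (H m) g) n) ⟩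
  g n + shift (geom m (H m ⊛ g)) n            ∎

pow-coeff₀ : ∀ f → f 0 ≡ 1 → ∀ i → pow f i 0 ≡ 1
pow-coeff₀ f f₀≡1 zero    = refl
pow-coeff₀ f f₀≡1 (suc i) = begin
  f 0 * pow f i 0 + 0  ≡⟨ +-identityʳ _ ⟩
  f 0 * pow f i 0      ≡⟨ cong₂ _*_ f₀≡1 (pow-coeff₀ f f₀≡1 i) ⟩
  1                    ∎

occ-singleton : ∀ d x → occ d [ x ] ≡ (if does (x ≟ d) then 1 else 0)
occ-singleton d x with x ≡ᵇ d
... | true  = refl
... | false = refl

occ-[≡] : ∀ {d x} → x ≡ d → occ d [ x ] ≡ 1
occ-[≡] {d} {x} x≡d = trans (occ-singleton d x) (cong (if_then 1 else 0) (dec-true (x ≟ d) x≡d))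

occ-[≢] : ∀ {d x} → x ≢ d → occ d [ x ] ≡ 0
occ-[≢] {d} {x} x≢d = trans (occ-singleton d x) (cong (if_then 1 else 0) (dec-false (x ≟ d) x≢d))

occ-++ : ∀ d u v → occ d (u ++ v) ≡ occ d u + occ d v
occ-++ d u v = trans (cong length (filter-++ (_≟ d) u v)) (length-++ (filter (_≟ d) u))

-- The filter tests does (suc x ≟ suc d) and does (x ≟ d) both reduce to x ≡ᵇ d.
occ-map-suc : ∀ d w → occ (suc d) (map suc w) ≡ occ d w
occ-map-suc d []      = refl
occ-map-suc d (x ∷ w) with x ≡ᵇ d
... | true  = cong suc (occ-map-suc d w)
... | false = occ-map-suc d w

occ-zero-map-suc : ∀ w → occ 0 (map suc w) ≡ 0
occ-zero-map-suc []      = refl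
occ-zero-map-suc (x ∷ w) = occ-zero-map-suc w

occ-singleton-cong : ∀ {d x e y} → (x ≡ d → y ≡ e) → (y ≡ e → x ≡ d) →
                     occ d [ x ] ≡ occ e [ y ]
occ-singleton-cong {d} {x} to from with x ≟ d
... | yes x≡d = trans (occ-[≡] x≡d) (sym (occ-[≡] (to x≡d)))
... | no  x≢d = trans (occ-[≢] x≢d) (sym (occ-[≢] (x≢d ∘ from)))

∑-occ-singleton : ∀ n r → ∑[ j < n ] occ (toℕ j) [ r ] ≡ (if r <ᵇ n then 1 else 0)
∑-occ-singleton zero    r       = refl
∑-occ-singleton (suc n) zero    = cong suc (sum-replicate-zero n)
∑-occ-singleton (suc n) (suc r) =
  trans (sum-cong-≗ {n} {λ j → occ (suc (toℕ j)) [ suc r ]} (λ j → occ-map-suc (toℕ j) [ r ]))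
        (∑-occ-singleton n r)

mono≡occ : ∀ d n → mono d n ≡ occ d [ n ]
mono≡occ d n with n ≟ d
... | yes n≡d = sym (occ-[≡] n≡d)
... | no  n≢d = sym (occ-[≢] n≢d)

mono-suc : ∀ d → mono (suc d) ≗ shift (mono d)
mono-suc d zero    = refl
mono-suc d (suc n) = trans (mono≡occ (suc d) (suc n)) (trans (occ-map-suc d [ n ]) (sym (mono≡occ d n)))

mono-⊛ : ∀ d g → mono d ⊛ g ≗ iter shift d g
mono-⊛ zero    g n = trans (⊛-congˡ mono-zero g n) (⊛-identityˡ g n)
  where
  mono-zero : mono 0 ≗ one
  mono-zero zero    = refl
  mono-zero (suc n) = refl
mono-⊛ (suc d) g n = begin
  (mono (suc d) ⊛ g) n   ≡⟨ ⊛-congˡ (mono-suc d) g n ⟩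
  (shift (mono d) ⊛ g) n ≡⟨ ⊛-shiftˡ (mono d) g n ⟩
  shift (mono d ⊛ g) n   ≡⟨ shift-cong (mono-⊛ d g) n ⟩
  iter shift (suc d) g n ∎

divMod-unique : ∀ {k} .{{_ : NonZero k}} {r j} q i →
                r < k → j < k → r + q * k ≡ j + i * k → r ≡ j × q ≡ i
divMod-unique {k} {r} {j} q i r<k j<k eq =
  r≡j , *-cancelʳ-≡ q i k (+-cancelˡ-≡ r _ _ (trans eq (cong (_+ i * k) (sym r≡j))))
  where
  r≡j : r ≡ j
  r≡j = begin
    r                ≡⟨ m<n⇒m%n≡m r<k ⟨
    r % k            ≡⟨ [m+kn]%n≡m%n r q k ⟨
    (r + q * k) % k  ≡⟨ cong (_% k) eq ⟩
    (j + i * k) % k  ≡⟨ [m+kn]%n≡m%n j i k ⟩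
    j % k            ≡⟨ m<n⇒m%n≡m j<k ⟩
    j                ∎

module Digits (m : ℕ) where

  k : ℕ
  k = suc m

  φ-prefix : ℕ → Word
  φ-prefix x = if x % k <ᵇ m then [ x / k * k ] else []

  φ-letter≡ : ∀ x → φ-letter k x ≡ φ-prefix x ++ [ suc x ]
  φ-letter≡ x with x % k <ᵇ m in r<ᵇm
  ... | true  = cong₂ (λ a b → a ∷ [ b ]) (*-comm k (x / k)) (begin
    k * (x / k) + x % k + 1  ≡⟨ kq+r+1≡ m (x / k) (x % k) ⟩
    suc (x % k + x / k * k)  ≡⟨ cong suc (m≡m%n+[m/n]*n x k) ⟨
    suc x                    ∎)
    where
    kq+r+1≡ : ∀ m q r → suc m * q + r + 1 ≡ suc (r + q * suc m)
    kq+r+1≡ = solve-∀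
  ... | false = cong [_] (begin
    k * (x / k) + k          ≡⟨ kq+k≡ m (x / k) ⟩
    suc (m + x / k * k)      ≡⟨ cong (λ r → suc (r + x / k * k)) r≡m ⟨
    suc (x % k + x / k * k)  ≡⟨ cong suc (m≡m%n+[m/n]*n x k) ⟨
    suc x                    ∎)
    where
    kq+k≡ : ∀ m q → suc m * q + suc m ≡ suc (m + q * suc m)
    kq+k≡ = solve-∀
    r≡m : x % k ≡ m
    r≡m = ≤-antisym (≤-pred (m%n<n x k)) (≮⇒≥ (λ r<m → subst T r<ᵇm (<⇒<ᵇ r<m)))

  occ-φ : ∀ d w → occ d (φ k w) ≡ occ d (map suc w) + occ d (concatMap φ-prefix w)
  occ-φ d []      = refl
  occ-φ d (x ∷ w) = begin
    occ d (φ-letter k x ++ φ k w)         ≡⟨ occ-++ d (φ-letter k x) (φ k w) ⟩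
    occ d (φ-letter k x) + occ d (φ k w)  ≡⟨ cong₂ _+_ letter (occ-φ d w) ⟩
    (a + b) + (u + v)                     ≡⟨ cong (_+ (u + v)) (+-comm a b) ⟩
    (b + a) + (u + v)                     ≡⟨ interchange b a u v ⟩
    (b + u) + (a + v)                     ≡⟨ cong₂ _+_ (occ-++ d [ suc x ] (map suc w))
                                                       (occ-++ d (φ-prefix x) (concatMap φ-prefix w)) ⟨
    occ d (map suc (x ∷ w)) + occ d (concatMap φ-prefix (x ∷ w)) ∎
    where
    a b u v : ℕ
    a = occ d (φ-prefix x)
    b = occ d [ suc x ]
    u = occ d (map suc w)
    v = occ d (concatMap φ-prefix w)
    letter : occ d (φ-letter k x) ≡ a + b
    letter = trans (cong (occ d) (φ-letter≡ x)) (occ-++ d (φ-prefix x) [ suc x ])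

  toℕ<k : (j : Fin m) → toℕ j < k
  toℕ<k j = m<n⇒m<1+n (toℕ<n j)

  occ-φ-prefix-≢ : ∀ {d} x → x / k * k ≢ d → occ d (φ-prefix x) ≡ 0
  occ-φ-prefix-≢ x qk≢d with x % k <ᵇ m
  ... | true  = occ-[≢] qk≢d
  ... | false = refl

  occ-φ-prefix-self : ∀ x → occ (x / k * k) (φ-prefix x) ≡ (if x % k <ᵇ m then 1 else 0)
  occ-φ-prefix-self x with x % k <ᵇ m
  ... | true  = occ-[≡] {x / k * k} refl
  ... | false = refl

  occ-φ-prefix-offset : ∀ i j x → j < m → occ (suc j + i * k) (φ-prefix x) ≡ 0
  occ-φ-prefix-offset i j x j<m =
    occ-φ-prefix-≢ x (λ qk≡ → 0≢1+n (proj₁ (divMod-unique (x / k) i z<s (s≤s j<m) qk≡)))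

  occ-φ-prefix-multiple : ∀ i x → occ (i * k) (φ-prefix x) ≡ ∑[ j < m ] occ (toℕ j + i * k) [ x ]
  occ-φ-prefix-multiple i x with x / k ≟ i
  ... | no q≢i = begin
    occ (i * k) (φ-prefix x)              ≡⟨ occ-φ-prefix-≢ x (q≢i ∘ *-cancelʳ-≡ (x / k) i k) ⟩
    0                                     ≡⟨ sum-replicate-zero m ⟨
    ∑[ j < m ] 0                          ≡⟨ sum-cong-≗ {m} {λ _ → 0} (λ j → sym (occ-[≢] (x≢ j))) ⟩
    ∑[ j < m ] occ (toℕ j + i * k) [ x ]  ∎
    where
    x≢ : ∀ j → x ≢ toℕ j + i * k
    x≢ j x≡ = q≢i (proj₂ (divMod-unique (x / k) i (m%n<n x k) (toℕ<k j)
                                          (trans (sym (m≡m%n+[m/n]*n x k)) x≡)))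
  ... | yes refl = begin
    occ (x / k * k) (φ-prefix x)              ≡⟨ occ-φ-prefix-self x ⟩
    (if x % k <ᵇ m then 1 else 0)             ≡⟨ ∑-occ-singleton m (x % k) ⟨
    ∑[ j < m ] occ (toℕ j) [ x % k ]          ≡⟨ sum-cong-≗ {m} {λ j → occ (toℕ j) [ x % k ]} same ⟩
    ∑[ j < m ] occ (toℕ j + x / k * k) [ x ]  ∎
    where
    to : ∀ j → x % k ≡ toℕ j → x ≡ toℕ j + x / k * k
    to j r≡j = trans (m≡m%n+[m/n]*n x k) (cong (_+ x / k * k) r≡j)
    from : ∀ j → x ≡ toℕ j + x / k * k → x % k ≡ toℕ j
    from j x≡ = proj₁ (divMod-unique (x / k) (x / k) (m%n<n x k) (toℕ<k j)
                                     (trans (sym (m≡m%n+[m/n]*n x k)) x≡))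
    same : ∀ j → occ (toℕ j) [ x % k ] ≡ occ (toℕ j + x / k * k) [ x ]
    same j = occ-singleton-cong (to j) (from j)

  occ-φ-prefixes-offset : ∀ i j w → j < m → occ (suc j + i * k) (concatMap φ-prefix w) ≡ 0
  occ-φ-prefixes-offset i j []      j<m = refl
  occ-φ-prefixes-offset i j (x ∷ w) j<m = begin
    occ (suc j + i * k) (φ-prefix x ++ concatMap φ-prefix w)
      ≡⟨ occ-++ (suc j + i * k) (φ-prefix x) (concatMap φ-prefix w) ⟩
    occ (suc j + i * k) (φ-prefix x) + occ (suc j + i * k) (concatMap φ-prefix w)
      ≡⟨ cong₂ _+_ (occ-φ-prefix-offset i j x j<m) (occ-φ-prefixes-offset i j w j<m) ⟩
    0 ∎

  occ-φ-prefixes-multiple : ∀ i w →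
                            occ (i * k) (concatMap φ-prefix w) ≡ ∑[ j < m ] occ (toℕ j + i * k) w
  occ-φ-prefixes-multiple i []      = sym (sum-replicate-zero m)
  occ-φ-prefixes-multiple i (x ∷ w) = begin
    occ (i * k) (φ-prefix x ++ concatMap φ-prefix w)
      ≡⟨ occ-++ (i * k) (φ-prefix x) (concatMap φ-prefix w) ⟩
    occ (i * k) (φ-prefix x) + occ (i * k) (concatMap φ-prefix w)
      ≡⟨ cong₂ _+_ (occ-φ-prefix-multiple i x) (occ-φ-prefixes-multiple i w) ⟩
    ∑[ j < m ] occ (toℕ j + i * k) [ x ] + ∑[ j < m ] occ (toℕ j + i * k) w
      ≡⟨ ∑-distrib-+ {m} (λ j → occ (toℕ j + i * k) [ x ]) (λ j → occ (toℕ j + i * k) w) ⟨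
    ∑[ j < m ] (occ (toℕ j + i * k) [ x ] + occ (toℕ j + i * k) w)
      ≡⟨ sum-cong-≗ {m} {λ j → occ (toℕ j + i * k) [ x ] + occ (toℕ j + i * k) w}
                    (λ j → sym (occ-++ (toℕ j + i * k) [ x ] w)) ⟩
    ∑[ j < m ] occ (toℕ j + i * k) (x ∷ w) ∎

  C-coeff₀ : ∀ d (f : Series) → f 0 ≡ 1 → C k d 0 ≡ iter shift d f 0
  C-coeff₀ zero    f f₀≡1 = sym f₀≡1
  C-coeff₀ (suc d) f f₀≡1 = refl

  C-offset : ∀ i j n → j < m → C k (suc j + i * k) (suc n) ≡ C k (j + i * k) n
  C-offset i j n j<m = begin
    occ (suc j + i * k) (φ k (W k n))
      ≡⟨ occ-φ (suc j + i * k) (W k n) ⟩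
    occ (suc j + i * k) (map suc (W k n)) + occ (suc j + i * k) (concatMap φ-prefix (W k n))
      ≡⟨ cong₂ _+_ (occ-map-suc (j + i * k) (W k n)) (occ-φ-prefixes-offset i j (W k n) j<m) ⟩
    C k (j + i * k) n + 0
      ≡⟨ +-identityʳ _ ⟩
    C k (j + i * k) n ∎

  C-multiple : ∀ i n →
               C k (i * k) (suc n) ≡ occ (i * k) (map suc (W k n)) + ∑[ j < m ] C k (toℕ j + i * k) n
  C-multiple i n = trans (occ-φ (i * k) (W k n))
                         (cong (occ (i * k) (map suc (W k n)) +_) (occ-φ-prefixes-multiple i (W k n)))

  C-divMod-closed-form : ∀ i j → j < k → C k (j + i * k) ≗ iter shift (j + i * k) (pow (H m) (suc i))
  C-divMod-closed-form i j       j<k       zero    =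
    C-coeff₀ (j + i * k) (pow (H m) (suc i)) (pow-coeff₀ (H m) refl (suc i))
  C-divMod-closed-form i (suc j) (s≤s j<m) (suc n) =
    trans (C-offset i j n j<m) (C-divMod-closed-form i j (m<n⇒m<1+n j<m) n)
  C-divMod-closed-form i zero    _         (suc n) = begin
    C k (i * k) (suc n)
      ≡⟨ C-multiple i n ⟩
    occ (i * k) (map suc (W k n)) + ∑[ j < m ] C k (toℕ j + i * k) n
      ≡⟨ cong₂ _+_ (successors i) (sum-cong-≗ {m} {λ j → C k (toℕ j + i * k) n} window) ⟩
    iter shift (i * k) Q (suc n) + ∑[ j < m ] iter shift (toℕ j + i * k) P n
      ≡⟨ cong (iter shift (i * k) Q (suc n) +_) (∑-iter-shift m (i * k) P n) ⟩
    iter shift (i * k) Q (suc n) + iter shift (i * k) G n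
      ≡⟨ cong (iter shift (i * k) Q (suc n) +_) (cong-app (iter-comm shift (i * k) G) (suc n)) ⟨
    iter shift (i * k) Q (suc n) + iter shift (i * k) (shift G) (suc n)
      ≡⟨ iter-shift-⊕ (i * k) Q (shift G) (suc n) ⟨
    iter shift (i * k) (Q ⊕ shift G) (suc n)
      ≡⟨ iter-shift-cong (i * k) (H-⊛-rec m Q) (suc n) ⟨
    iter shift (i * k) P (suc n) ∎
    where
    P Q G : Series
    P = pow (H m) (suc i)
    Q = pow (H m) i
    G = geom m P
    window : ∀ j → C k (toℕ j + i * k) n ≡ iter shift (toℕ j + i * k) P n
    window j = C-divMod-closed-form i (toℕ j) (toℕ<k j) n
    successors : ∀ l → occ (l * k) (map suc (W k n)) ≡ iter shift (l * k) (pow (H m) l) (suc n)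
    successors zero    = occ-zero-map-suc (W k n)
    successors (suc l) = trans (occ-map-suc (m + l * k) (W k n)) (C-divMod-closed-form l m ≤-refl n)

  C-closed-form : ∀ d → C k d ≗ iter shift d (pow (H m) (suc (d / k)))
  C-closed-form d n = subst (λ e → C k e n ≡ iter shift e (pow (H m) (suc (d / k))) n)
                            (sym (m≡m%n+[m/n]*n d k))
                            (C-divMod-closed-form (d / k) (d % k) (m%n<n d k) n)

-- The identity holds for every k ≥ 1.
theorem4p2 : (k : ℕ) .{{_ : NonZero k}} → 3 ≤ k → (d : ℕ) →
    ∀ n → C k d n ≡ (mono d ⊛ pow (H (k ∸ 1)) (d / k + 1)) n
theorem4p2 (suc m) _ d n = begin
  C k d n                                   ≡⟨ C-closed-form d n ⟩
  iter shift d (pow (H m) (suc (d / k))) n  ≡⟨ mono-⊛ d (pow (H m) (suc (d / k))) n ⟨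
  (mono d ⊛ pow (H m) (suc (d / k))) n      ≡⟨ cong (λ e → (mono d ⊛ pow (H m) e) n) (+-comm 1 (d / k)) ⟩
  (mono d ⊛ pow (H m) (d / k + 1)) n        ∎
  where open Digits m
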